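{- Let $n \ge 1$ and let $T$ be a state of the Bergman Game reachable from ${}_0(n)$ by a finite sequence of moves, such that $T_i \in \{0,1\}$ for all $i$. Let $m = \min\{i : T_i > 0\}$ be the index of the leftmost chip of $T$, and suppose $m \leq -\log_\varphi n - 5$, where $\varphi = \frac{1+\sqrt5}{2}$. Then $T_m = 1$, $T_{m+1} = 1$ and $T_{m+2} = 0$ (i.e., reading from left to right in increasing index, the left edge of $T$ has the form $110\ldots$).
   Context: The Bergman Game: a state is a function $a:\mathbb{Z}\to\mathbb{Z}_{\geq 0}$ with finite support; $a_i$ is the number of chips (summands) at index $i$. A combine at index $i$ is available if $a_i \geq 1$ and $a_{i+1} \geq 1$; it decreases $a_i$ and $a_{i+1}$ by $1$ each and increases $a_{i+2}$ by $1$. A split at index $i$ is available if $a_i \geq 2$; it decreases $a_i$ by $2$ and increases each of $a_{i+1}$ and $a_{i-2}$ by $1$. The state ${}_0(n)$ has $n$ chips at index $0$ and none elsewhere. -}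

module Defs where

open import Data.Nat as ℕ using (ℕ; zero; suc; _∸_)
open import Data.Integer as ℤ using (ℤ; +_; _+_; _-_; _*_; -_; _≤_; _<_; _≟_)
open import Data.Product using (Σ; ∃; _×_; _,_)
open import Data.Sum using (_⊎_)
open import Relation.Nullary using (yes; no)
open import Relation.Binary.PropositionalEquality using (_≡_)

-- A state: number of chips at each index (finite support is automatic
-- for every state reachable from ₀(n)).
State : Set
State = ℤ → ℕ

init : ℕ → State
init n j with j ≟ + 0
... | yes _ = n
... | no  _ = 0

combine : State → ℤ → State
combine a i j with j ≟ i | j ≟ i + + 1 | j ≟ i + + 2
... | yes _ | _     | _     = a j ∸ 1
... | no  _ | yes _ | _     = a j ∸ 1
... | no  _ | no  _ | yes _ = suc (a j)
... | no  _ | no  _ | no  _ = a j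

split : State → ℤ → State
split a i j with j ≟ i | j ≟ i + + 1 | j ≟ i - + 2
... | yes _ | _     | _     = a j ∸ 2
... | no  _ | yes _ | _     = suc (a j)
... | no  _ | no  _ | yes _ = suc (a j)
... | no  _ | no  _ | no  _ = a j

data Move (a b : State) : Set where
  combineMove : (i : ℤ) → 1 ℕ.≤ a i → 1 ℕ.≤ a (i + + 1) →
                (∀ j → b j ≡ combine a i j) → Move a b
  splitMove   : (i : ℤ) → 2 ℕ.≤ a i →
                (∀ j → b j ≡ split a i j) → Move a b

data ReachableFrom (a : State) : State → Set where
  start : ∀ {b} → (∀ j → b j ≡ a j) → ReachableFrom a b
  step  : ∀ {b c} → ReachableFrom a b → Move b c → ReachableFrom a c

-- Exact arithmetic in ℤ[√5] to express comparisons with powers of φ.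

infix 4 _+√5·_
record ℤ√5 : Set where
  constructor _+√5·_
  field
    re : ℤ
    im : ℤ
open ℤ√5 public

_*√_ : ℤ√5 → ℤ√5 → ℤ√5
(a +√5· b) *√ (c +√5· d) = (a * c + + 5 * (b * d)) +√5· (a * d + b * c)

_^√_ : ℤ√5 → ℕ → ℤ√5
x ^√ zero  = + 1 +√5· + 0
x ^√ suc k = x *√ (x ^√ k)

-- the real number a + b√5 is ≥ 0
NonNeg : ℤ√5 → Set
NonNeg (a +√5· b) =
    (+ 0 ≤ a × + 0 ≤ b)
  ⊎ (+ 0 ≤ a × b < + 0 × + 5 * (b * b) ≤ a * a)
  ⊎ (a < + 0 × + 0 < b × a * a ≤ + 5 * (b * b))

-- n ≤ φ^k  where φ = (1+√5)/2, i.e.  2^k · n ≤ (1+√5)^k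
_≤φ^_ : ℕ → ℕ → Set
n ≤φ^ k = NonNeg ((re p - + (2 ℕ.^ k ℕ.* n)) +√5· im p)
  where p = (+ 1 +√5· + 1) ^√ k

-- m ≤ -log_φ n - 5 for an integer m and n ≥ 1.  Since log_φ n ≥ 0 this
-- forces -m-5 = k ∈ ℕ, and then it is equivalent to log_φ n ≤ k, i.e. n ≤ φ^k.
LeftBound : ℕ → ℤ → Set
LeftBound n m = Σ ℕ λ k → (m ≡ - (+ k) - + 5) × (n ≤φ^ k)

-- Weight a chip at index j by F(j - R), where F is the Fibonacci sequence run
-- backwards to negative indices and R bounds the support of every state met on the
-- way from ₀(n).  Since F(i+2) = F(i+1) + F(i) and 2F(i) = F(i+1) + F(i-2), combines
-- and splits preserve the total weight, which therefore stays n·F(-R) = ±n·F(R).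
-- Read from the right end of the window, the weights alternate in sign, and the
-- signed partial sums of a 0/1 state lie between -F(u) and F(u+1).  If the leftmost
-- chip sits at m = R - N and the state does not start with 110, these bounds push
-- the total above F(N-2) in absolute value; but n ≤ φ^k gives n ≤ F(k+2), hence
-- n·F(R) ≤ F(R+k+2) = F(N-3).
module Submission where

open import Defs
open import Data.Nat using (ℕ; _≤_)
open import Data.Integer using (ℤ; +_; _+_; _<_)
open import Relation.Binary.PropositionalEquality using (_≡_)
open import Data.Product using (_×_)

open import Data.Nat as ℕ using (zero; suc; _∸_; z≤n; s≤s)
import Data.Nat.Properties as ℕP
open import Data.Nat.Tactic.RingSolver using (solve-∀)
open import Data.Integer as ℤ using (-[1+_]; _-_; _*_; -_; ∣_∣; +≤+; +<+; -≤+; _≟_)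
import Data.Integer.Properties as ℤP
import Data.Integer.Tactic.RingSolver as ℤ-Solver
open import Data.Product using (Σ; _,_; proj₁; proj₂)
open import Data.Sum using (_⊎_; inj₁; inj₂)
open import Data.Empty using (⊥; ⊥-elim)
open import Function using (_∘_)
open import Algebra.Properties.AbelianGroup ℤP.+-0-abelianGroup using (∙-cancelˡ)
open import Relation.Nullary using (yes; no)
open import Relation.Binary.PropositionalEquality
  using (_≢_; refl; sym; trans; cong; cong₂; subst; subst₂; module ≡-Reasoning)

fib : ℕ → ℕ
fib zero          = 0
fib (suc zero)    = 1
fib (suc (suc n)) = fib n ℕ.+ fib (suc n)

fib-≤-suc : ∀ n → fib n ≤ fib (suc n)
fib-≤-suc zero    = z≤n
fib-≤-suc (suc n) = ℕP.m≤n+m (fib (suc n)) (fib n)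

fib-suc-pos : ∀ n → 1 ≤ fib (suc n)
fib-suc-pos zero    = s≤s z≤n
fib-suc-pos (suc n) = ℕP.≤-trans (fib-suc-pos n) (fib-≤-suc (suc n))

fib-<-suc : ∀ n → fib (2 ℕ.+ n) ℕ.< fib (3 ℕ.+ n)
fib-<-suc n = ℕP.+-monoˡ-≤ (fib (2 ℕ.+ n)) (fib-suc-pos n)

fib-*-≤ : ∀ a b → fib a ℕ.* fib b ≤ fib (a ℕ.+ b)
fib-*-≤ zero          b = z≤n
fib-*-≤ (suc zero)    b = ℕP.≤-trans (ℕP.≤-reflexive (ℕP.*-identityˡ (fib b))) (fib-≤-suc b)
fib-*-≤ (suc (suc a)) b = begin
  (fib a ℕ.+ fib (suc a)) ℕ.* fib b          ≡⟨ ℕP.*-distribʳ-+ (fib b) (fib a) (fib (suc a)) ⟩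
  fib a ℕ.* fib b ℕ.+ fib (suc a) ℕ.* fib b  ≤⟨ ℕP.+-mono-≤ (fib-*-≤ a b) (fib-*-≤ (suc a) b) ⟩
  fib (a ℕ.+ b) ℕ.+ fib (suc a ℕ.+ b)        ∎
  where open ℕP.≤-Reasoning

powRe powIm : ℕ → ℕ
powRe zero    = 1
powRe (suc k) = powRe k ℕ.+ 5 ℕ.* powIm k
powIm zero    = 0
powIm (suc k) = powRe k ℕ.+ powIm k

[1+√5]^≡ : ∀ k → (+ 1 +√5· + 1) ^√ k ≡ (+ powRe k +√5· + powIm k)
[1+√5]^≡ zero    = refl
[1+√5]^≡ (suc k) rewrite [1+√5]^≡ k = cong₂ _+√5·_ re≡ im≡
  where
  x = powRe k
  y = powIm k
  re≡ : + 1 * + x + + 5 * (+ 1 * + y) ≡ + (x ℕ.+ 5 ℕ.* y)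
  re≡ = begin
    + 1 * + x + + 5 * (+ 1 * + y) ≡⟨ unit (+ x) (+ y) ⟩
    + x + + 5 * + y               ≡⟨ cong (λ v → + x + v) (ℤP.pos-* 5 y) ⟨
    + x + + (5 ℕ.* y)             ≡⟨ ℤP.pos-+ x (5 ℕ.* y) ⟨
    + (x ℕ.+ 5 ℕ.* y)             ∎
    where
    open ≡-Reasoning
    unit : ∀ a b → + 1 * a + + 5 * (+ 1 * b) ≡ a + + 5 * b
    unit = ℤ-Solver.solve-∀
  im≡ : + 1 * + y + + 1 * + x ≡ + (x ℕ.+ y)
  im≡ = trans (unit (+ x) (+ y)) (sym (ℤP.pos-+ x y))
    where
    unit : ∀ a b → + 1 * b + + 1 * a ≡ a + b
    unit = ℤ-Solver.solve-∀

powRe+powIm : ∀ k → powRe k ℕ.+ powIm k ≡ 2 ℕ.^ k ℕ.* fib (suc k)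
powIm+powIm : ∀ k → powIm k ℕ.+ powIm k ≡ 2 ℕ.^ k ℕ.* fib k
powRe+powIm zero    = refl
powRe+powIm (suc k) = begin
  powRe k ℕ.+ 5 ℕ.* powIm k ℕ.+ (powRe k ℕ.+ powIm k)
    ≡⟨ regroup (powRe k) (powIm k) ⟩
  2 ℕ.* (powRe k ℕ.+ powIm k) ℕ.+ 2 ℕ.* (powIm k ℕ.+ powIm k)
    ≡⟨ cong₂ (λ u v → 2 ℕ.* u ℕ.+ 2 ℕ.* v) (powRe+powIm k) (powIm+powIm k) ⟩
  2 ℕ.* (2 ℕ.^ k ℕ.* fib (suc k)) ℕ.+ 2 ℕ.* (2 ℕ.^ k ℕ.* fib k)
    ≡⟨ factor (2 ℕ.^ k) (fib (suc k)) (fib k) ⟩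
  2 ℕ.* 2 ℕ.^ k ℕ.* (fib k ℕ.+ fib (suc k))
    ∎
  where
  open ≡-Reasoning
  regroup : ∀ x y → x ℕ.+ 5 ℕ.* y ℕ.+ (x ℕ.+ y) ≡ 2 ℕ.* (x ℕ.+ y) ℕ.+ 2 ℕ.* (y ℕ.+ y)
  regroup = solve-∀
  factor : ∀ p a b → 2 ℕ.* (p ℕ.* a) ℕ.+ 2 ℕ.* (p ℕ.* b) ≡ 2 ℕ.* p ℕ.* (b ℕ.+ a)
  factor = solve-∀
powIm+powIm zero    = refl
powIm+powIm (suc k) = begin
  powRe k ℕ.+ powIm k ℕ.+ (powRe k ℕ.+ powIm k)
    ≡⟨ cong₂ ℕ._+_ (powRe+powIm k) (powRe+powIm k) ⟩
  2 ℕ.^ k ℕ.* fib (suc k) ℕ.+ 2 ℕ.^ k ℕ.* fib (suc k)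
    ≡⟨ double (2 ℕ.^ k) (fib (suc k)) ⟩
  2 ℕ.* 2 ℕ.^ k ℕ.* fib (suc k)
    ∎
  where
  open ≡-Reasoning
  double : ∀ p a → p ℕ.* a ℕ.+ p ℕ.* a ≡ 2 ℕ.* p ℕ.* a
  double = solve-∀

powRe+3powIm : ∀ k → powRe k ℕ.+ 3 ℕ.* powIm k ≡ 2 ℕ.^ k ℕ.* fib (2 ℕ.+ k)
powRe+3powIm k = begin
  powRe k ℕ.+ 3 ℕ.* powIm k
    ≡⟨ regroup (powRe k) (powIm k) ⟩
  (powRe k ℕ.+ powIm k) ℕ.+ (powIm k ℕ.+ powIm k)
    ≡⟨ cong₂ ℕ._+_ (powRe+powIm k) (powIm+powIm k) ⟩
  2 ℕ.^ k ℕ.* fib (suc k) ℕ.+ 2 ℕ.^ k ℕ.* fib k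
    ≡⟨ factor (2 ℕ.^ k) (fib (suc k)) (fib k) ⟩
  2 ℕ.^ k ℕ.* (fib k ℕ.+ fib (suc k))
    ∎
  where
  open ≡-Reasoning
  regroup : ∀ x y → x ℕ.+ 3 ℕ.* y ≡ (x ℕ.+ y) ℕ.+ (y ℕ.+ y)
  regroup = solve-∀
  factor : ∀ p a b → p ℕ.* a ℕ.+ p ℕ.* b ≡ p ℕ.* (b ℕ.+ a)
  factor = solve-∀

x²≤5y²⇒x≤3y : ∀ x y → x ℕ.* x ≤ 5 ℕ.* (y ℕ.* y) → x ≤ 3 ℕ.* y
x²≤5y²⇒x≤3y x y x²≤5y² with x ℕ.≤? 3 ℕ.* y
... | yes x≤3y = x≤3y
... | no  x≰3y = ⊥-elim (ℕP.<⇒≱ 5y²<x² x²≤5y²)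
  where
  open ℕP.≤-Reasoning
  expand : ∀ y → (3 ℕ.* y ℕ.+ 1) ℕ.* (3 ℕ.* y ℕ.+ 1) ≡ suc (5 ℕ.* (y ℕ.* y) ℕ.+ (4 ℕ.* (y ℕ.* y) ℕ.+ 6 ℕ.* y))
  expand = solve-∀
  3y+1≤x : 3 ℕ.* y ℕ.+ 1 ≤ x
  3y+1≤x = subst (_≤ x) (ℕP.+-comm 1 (3 ℕ.* y)) (ℕP.≰⇒> x≰3y)
  5y²<x² : 5 ℕ.* (y ℕ.* y) ℕ.< x ℕ.* x
  5y²<x² = begin-strict
    5 ℕ.* (y ℕ.* y)                              <⟨ s≤s (ℕP.m≤m+n _ _) ⟩
    suc (5 ℕ.* (y ℕ.* y) ℕ.+ (4 ℕ.* (y ℕ.* y) ℕ.+ 6 ℕ.* y)) ≡⟨ expand y ⟨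
    (3 ℕ.* y ℕ.+ 1) ℕ.* (3 ℕ.* y ℕ.+ 1)          ≤⟨ ℕP.*-mono-≤ 3y+1≤x 3y+1≤x ⟩
    x ℕ.* x                                      ∎

nonNeg⇒-3im≤re : ∀ a y → NonNeg (a +√5· + y) → - + (3 ℕ.* y) ℤ.≤ a
nonNeg⇒-3im≤re a         y (inj₁ (0≤a , _))             = ℤP.≤-trans ℤP.neg-≤-pos 0≤a
nonNeg⇒-3im≤re a         y (inj₂ (inj₁ (_ , +<+ () , _)))
nonNeg⇒-3im≤re (+ _)     y (inj₂ (inj₂ (+<+ () , _)))
nonNeg⇒-3im≤re -[1+ t ]  y (inj₂ (inj₂ (_ , _ , a²≤5y²))) =
  ℤP.neg-mono-≤ (+≤+ (x²≤5y²⇒x≤3y (suc t) y (ℤP.drop‿+≤+ (subst (_ ℤ.≤_) 5y²≡ a²≤5y²))))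
  where
  5y²≡ : + 5 * (+ y * + y) ≡ + (5 ℕ.* (y ℕ.* y))
  5y²≡ = trans (cong (+ 5 *_) (sym (ℤP.pos-* y y))) (sym (ℤP.pos-* 5 (y ℕ.* y)))

-b≤a-c⇒c≤a+b : ∀ a b c → - + b ℤ.≤ + a - + c → c ≤ a ℕ.+ b
-b≤a-c⇒c≤a+b a b c h = ℤP.drop‿+≤+ (subst₂ ℤ._≤_ (lhs (+ b) (+ c)) (trans (rhs (+ a) (+ b) (+ c)) (sym (ℤP.pos-+ a b)))
                                         (ℤP.+-monoˡ-≤ (+ c + + b) h))
  where
  lhs : ∀ (b c : ℤ) → - b + (c + b) ≡ c
  lhs = ℤ-Solver.solve-∀
  rhs : ∀ (a b c : ℤ) → a - c + (c + b) ≡ a + b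
  rhs = ℤ-Solver.solve-∀

≤φ^⇒≤fib : ∀ n k → n ≤φ^ k → n ≤ fib (2 ℕ.+ k)
≤φ^⇒≤fib n k n≤φ^k = ℕP.*-cancelˡ-≤ (2 ℕ.^ k) {{ℕP.m^n≢0 2 k}} (begin
  2 ℕ.^ k ℕ.* n              ≤⟨ -b≤a-c⇒c≤a+b (powRe k) (3 ℕ.* powIm k) _ (nonNeg⇒-3im≤re _ (powIm k) nonNeg) ⟩
  powRe k ℕ.+ 3 ℕ.* powIm k  ≡⟨ powRe+3powIm k ⟩
  2 ℕ.^ k ℕ.* fib (2 ℕ.+ k)  ∎)
  where
  open ℕP.≤-Reasoning
  nonNeg : NonNeg ((+ powRe k - + (2 ℕ.^ k ℕ.* n)) +√5· + powIm k)
  nonNeg = subst (λ p → NonNeg ((re p - + (2 ℕ.^ k ℕ.* n)) +√5· im p)) ([1+√5]^≡ k) n≤φ^k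

σ : ℕ → ℤ
σ zero    = + 1
σ (suc j) = - σ j

σ*σ≡1 : ∀ j → σ j * σ j ≡ + 1
σ*σ≡1 zero    = refl
σ*σ≡1 (suc j) = trans (neg*neg (σ j)) (σ*σ≡1 j)
  where
  neg*neg : ∀ x → - x * - x ≡ x * x
  neg*neg = ℤ-Solver.solve-∀

∣σ*∣ : ∀ j i → ∣ σ j * i ∣ ≡ ∣ i ∣
∣σ*∣ j i = trans (ℤP.abs-* (σ j) i) (trans (cong (ℕ._* ∣ i ∣) (∣σ∣ j)) (ℕP.*-identityˡ ∣ i ∣))
  where
  ∣σ∣ : ∀ j → ∣ σ j ∣ ≡ 1
  ∣σ∣ zero    = refl
  ∣σ∣ (suc j) = trans (ℤP.∣-i∣≡∣i∣ (σ j)) (∣σ∣ j)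

i≤+∣i∣ : ∀ i → i ℤ.≤ + ∣ i ∣
i≤+∣i∣ (+ n)    = ℤP.≤-refl
i≤+∣i∣ -[1+ n ] = -≤+

-- The Fibonacci recurrence run backwards: F(-n) = (-1)^(n+1) F(n).
fibℤ : ℤ → ℤ
fibℤ (+ n)    = + fib n
fibℤ -[1+ n ] = σ n * + fib (suc n)

∣fibℤ-neg∣ : ∀ u → ∣ fibℤ (- + u) ∣ ≡ fib u
∣fibℤ-neg∣ zero    = refl
∣fibℤ-neg∣ (suc u) = ∣σ*∣ u (+ fib (suc u))

FibonacciLike : (ℤ → ℤ) → Set
FibonacciLike W = ∀ j → W (j + + 2) ≡ W (j + + 1) + W j

fibℤ-fibonacciLike : FibonacciLike fibℤ
fibℤ-fibonacciLike (+ n) rewrite ℕP.+-comm n 2 | ℕP.+-comm n 1 =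
  cong +_ (ℕP.+-comm (fib n) (fib (suc n)))
fibℤ-fibonacciLike -[1+ 0 ]           = refl
fibℤ-fibonacciLike -[1+ 1 ]           = refl
fibℤ-fibonacciLike -[1+ suc (suc n) ] = begin
  σ n * + fib (suc n)
    ≡⟨ alternate (σ n) (+ fib (suc n)) (+ fib (2 ℕ.+ n)) ⟩
  - σ n * + fib (2 ℕ.+ n) + - - σ n * (+ fib (suc n) + + fib (2 ℕ.+ n))
    ≡⟨ cong (λ v → - σ n * + fib (2 ℕ.+ n) + - - σ n * v) (ℤP.pos-+ (fib (suc n)) (fib (2 ℕ.+ n))) ⟨
  - σ n * + fib (2 ℕ.+ n) + - - σ n * + fib (3 ℕ.+ n)
    ∎
  where
  open ≡-Reasoning
  alternate : ∀ s a b → s * a ≡ - s * b + - - s * (a + b)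
  alternate = ℤ-Solver.solve-∀

fibonacciLike-shift : ∀ {W} → FibonacciLike W → ∀ c → FibonacciLike (λ j → W (j + c))
fibonacciLike-shift {W} W-fib c j = begin
  W (j + + 2 + c)             ≡⟨ cong W (swap j (+ 2) c) ⟩
  W (j + c + + 2)             ≡⟨ W-fib (j + c) ⟩
  W (j + c + + 1) + W (j + c) ≡⟨ cong (λ v → W v + W (j + c)) (swap j (+ 1) c) ⟨
  W (j + + 1 + c) + W (j + c) ∎
  where
  open ≡-Reasoning
  swap : ∀ a b c → a + b + c ≡ a + c + b
  swap = ℤ-Solver.solve-∀

sumTo : ℕ → (ℕ → ℤ) → ℤ
sumTo zero    f = + 0
sumTo (suc K) f = sumTo K f + f K

sumTo-cong : ∀ K {f h} → (∀ u → f u ≡ h u) → sumTo K f ≡ sumTo K h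
sumTo-cong zero    f≗h = refl
sumTo-cong (suc K) f≗h = cong₂ _+_ (sumTo-cong K f≗h) (f≗h K)

sumTo-+ : ∀ K f h → sumTo K (λ u → f u + h u) ≡ sumTo K f + sumTo K h
sumTo-+ zero    f h = refl
sumTo-+ (suc K) f h = trans (cong (_+ (f K + h K)) (sumTo-+ K f h)) (interchange (sumTo K f) (sumTo K h) (f K) (h K))
  where
  interchange : ∀ a b c d → a + b + (c + d) ≡ a + c + (b + d)
  interchange = ℤ-Solver.solve-∀

sumTo-*ˡ : ∀ K c f → sumTo K (λ u → c * f u) ≡ c * sumTo K f
sumTo-*ˡ zero    c f = sym (ℤP.*-zeroʳ c)
sumTo-*ˡ (suc K) c f = trans (cong (_+ c * f K) (sumTo-*ˡ K c f)) (sym (ℤP.*-distribˡ-+ c (sumTo K f) (f K)))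

sumTo-zero : ∀ K f → (∀ u → u ℕ.< K → f u ≡ + 0) → sumTo K f ≡ + 0
sumTo-zero zero    f f≡0 = refl
sumTo-zero (suc K) f f≡0 = cong₂ _+_ (sumTo-zero K f (λ u u<K → f≡0 u (ℕP.m<n⇒m<1+n u<K))) (f≡0 K ℕP.≤-refl)

sumTo-point : ∀ K f {w} → w ℕ.< K → (∀ u → u ≢ w → f u ≡ + 0) → sumTo K f ≡ f w
sumTo-point (suc K) f {w} w<1+K f≡0 with w ℕ.≟ K
... | yes refl = trans (cong (_+ f w) (sumTo-zero w f (λ u u<w → f≡0 u (ℕP.<⇒≢ u<w)))) (ℤP.+-identityˡ (f w))
... | no  w≢K  = trans (cong₂ _+_ (sumTo-point K f (ℕP.≤∧≢⇒< (ℕP.≤-pred w<1+K) w≢K) f≡0) (f≡0 K (w≢K ∘ sym)))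
                       (ℤP.+-identityʳ (f w))

sumTo-tail : ∀ K f {N} → (∀ u → N ≤ u → f u ≡ + 0) → N ≤ K → sumTo K f ≡ sumTo N f
sumTo-tail zero    f f≡0 z≤n = refl
sumTo-tail (suc K) f {N} f≡0 N≤1+K with ℕP.m≤n⇒m<n∨m≡n N≤1+K
... | inj₂ refl  = refl
... | inj₁ N<1+K = trans (cong₂ _+_ (sumTo-tail K f f≡0 (ℕP.≤-pred N<1+K)) (f≡0 K (ℕP.≤-pred N<1+K)))
                         (ℤP.+-identityʳ (sumTo N f))

Window : ℕ → ℤ → Set
Window R j = - + R ℤ.≤ j × j ℤ.≤ + R

windowSum : ℕ → (ℤ → ℤ) → ℤ
windowSum R f = sumTo (suc (R ℕ.+ R)) (λ u → f (+ R - + u))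

c-[c-x]≡x : ∀ c x → c - (c - x) ≡ x
c-[c-x]≡x = ℤ-Solver.solve-∀

-+-injective : ∀ c {u w} → c - + u ≡ c - + w → u ≡ w
-+-injective c {u} {w} eq = ℤP.+-injective (begin
  + u           ≡⟨ c-[c-x]≡x c (+ u) ⟨
  c - (c - + u) ≡⟨ cong (_-_ c) eq ⟩
  c - (c - + w) ≡⟨ c-[c-x]≡x c (+ w) ⟩
  + w           ∎)
  where open ≡-Reasoning

window-offset : ∀ {R p} → Window R p → Σ ℕ λ w → (+ R - + w ≡ p) × w ℕ.< suc (R ℕ.+ R)
window-offset {R} {p} (-R≤p , p≤R) = ∣ + R - p ∣ , R-w≡p , s≤s (ℤP.drop‿+≤+ w≤R+R)
  where
  w≡R-p : + ∣ + R - p ∣ ≡ + R - p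
  w≡R-p = ℤP.0≤i⇒+∣i∣≡i (ℤP.i≤j⇒0≤j-i p≤R)
  R-w≡p : + R - + ∣ + R - p ∣ ≡ p
  R-w≡p = trans (cong (_-_ (+ R)) w≡R-p) (c-[c-x]≡x (+ R) p)
  w≤R+R : + ∣ + R - p ∣ ℤ.≤ + (R ℕ.+ R)
  w≤R+R = subst₂ ℤ._≤_ (sym w≡R-p) (trans (cong (_+_ (+ R)) (ℤP.neg-involutive (+ R))) (sym (ℤP.pos-+ R R)))
                 (ℤP.+-monoʳ-≤ (+ R) (ℤP.neg-mono-≤ -R≤p))

window-offset-≤ : ∀ {R N} → Window R (+ R - + N) → N ≤ R ℕ.+ R
window-offset-≤ {R} N∈R with window-offset N∈R
... | w , R-w≡R-N , w<len = subst (_≤ R ℕ.+ R) (-+-injective (+ R) R-w≡R-N) (ℕP.≤-pred w<len)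

δ : ℤ → ℤ → ℤ
δ p j with j ≟ p
... | yes _ = + 1
... | no  _ = + 0

δ-diag : ∀ p → δ p p ≡ + 1
δ-diag p with p ≟ p
... | yes _   = refl
... | no  p≢p = ⊥-elim (p≢p refl)

δ-off : ∀ {p j} → j ≢ p → δ p j ≡ + 0
δ-off {p} {j} j≢p with j ≟ p
... | yes j≡p = ⊥-elim (j≢p j≡p)
... | no  _   = refl

windowSum-δ : ∀ {R p} (f : ℤ → ℤ) → Window R p → windowSum R (λ j → δ p j * f j) ≡ f p
windowSum-δ {R} {p} f p∈R with window-offset p∈R
... | w , R-w≡p , w<len = begin
  windowSum R (λ j → δ p j * f j) ≡⟨ sumTo-point (suc (R ℕ.+ R)) (λ u → δ p (+ R - + u) * f (+ R - + u)) w<len vanish ⟩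
  δ p (+ R - + w) * f (+ R - + w) ≡⟨ cong (λ j → δ p j * f j) R-w≡p ⟩
  δ p p * f p                     ≡⟨ cong (_* f p) (δ-diag p) ⟩
  + 1 * f p                       ≡⟨ ℤP.*-identityˡ (f p) ⟩
  f p                             ∎
  where
  open ≡-Reasoning
  vanish : ∀ u → u ≢ w → δ p (+ R - + u) * f (+ R - + u) ≡ + 0
  vanish u u≢w = trans (cong (_* f (+ R - + u)) (δ-off (λ eq → u≢w (-+-injective (+ R) (trans eq (sym R-w≡p))))))
                       (ℤP.*-zeroˡ (f (+ R - + u)))

windowSum-δ³ : ∀ {R p q r} a b c (f : ℤ → ℤ) → Window R p → Window R q → Window R r →
  windowSum R (λ j → (a * δ p j + (b * δ q j + c * δ r j)) * f j) ≡ a * f p + (b * f q + c * f r)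
windowSum-δ³ {R} {p} {q} {r} a b c f p∈R q∈R r∈R = begin
  sumTo K (λ u → (a * δ p (j u) + (b * δ q (j u) + c * δ r (j u))) * f (j u))
    ≡⟨ sumTo-cong K {h = λ u → a * P u + (b * Q u + c * S u)}
                  (λ u → distrib a b c (δ p (j u)) (δ q (j u)) (δ r (j u)) (f (j u))) ⟩
  sumTo K (λ u → a * P u + (b * Q u + c * S u))
    ≡⟨ sumTo-+ K (λ u → a * P u) (λ u → b * Q u + c * S u) ⟩
  sumTo K (λ u → a * P u) + sumTo K (λ u → b * Q u + c * S u)
    ≡⟨ cong (_+_ (sumTo K (λ u → a * P u))) (sumTo-+ K (λ u → b * Q u) (λ u → c * S u)) ⟩
  sumTo K (λ u → a * P u) + (sumTo K (λ u → b * Q u) + sumTo K (λ u → c * S u))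
    ≡⟨ cong₂ (λ x y → x + (y + sumTo K (λ u → c * S u))) (sumTo-*ˡ K a P) (sumTo-*ˡ K b Q) ⟩
  a * sumTo K P + (b * sumTo K Q + sumTo K (λ u → c * S u))
    ≡⟨ cong (λ z → a * sumTo K P + (b * sumTo K Q + z)) (sumTo-*ˡ K c S) ⟩
  a * sumTo K P + (b * sumTo K Q + c * sumTo K S)
    ≡⟨ cong₂ (λ x y → a * x + y) (windowSum-δ f p∈R)
             (cong₂ (λ x y → b * x + c * y) (windowSum-δ f q∈R) (windowSum-δ f r∈R)) ⟩
  a * f p + (b * f q + c * f r)
    ∎
  where
  open ≡-Reasoning
  K = suc (R ℕ.+ R)
  j : ℕ → ℤ
  j u = + R - + u
  P Q S : ℕ → ℤ
  P u = δ p (j u) * f (j u)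
  Q u = δ q (j u) * f (j u)
  S u = δ r (j u) * f (j u)
  distrib : ∀ a b c x y z v → (a * x + (b * y + c * z)) * v ≡ a * (x * v) + (b * (y * v) + c * (z * v))
  distrib = ℤ-Solver.solve-∀

i+1≢i : ∀ i → i + + 1 ≢ i
i+1≢i i eq with ∙-cancelˡ i (+ 1) (+ 0) (trans eq (sym (ℤP.+-identityʳ i)))
... | ()

i+2≢i : ∀ i → i + + 2 ≢ i
i+2≢i i eq with ∙-cancelˡ i (+ 2) (+ 0) (trans eq (sym (ℤP.+-identityʳ i)))
... | ()

i+2≢i+1 : ∀ i → i + + 2 ≢ i + + 1
i+2≢i+1 i eq with ∙-cancelˡ i (+ 2) (+ 1) eq
... | ()

i-2≢i : ∀ i → i - + 2 ≢ i
i-2≢i i eq with ∙-cancelˡ i (- + 2) (+ 0) (trans eq (sym (ℤP.+-identityʳ i)))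
... | ()

i-2≢i+1 : ∀ i → i - + 2 ≢ i + + 1
i-2≢i+1 i eq with ∙-cancelˡ i (- + 2) (+ 1) eq
... | ()

+[x∸1]≡ : ∀ {x} → 1 ≤ x → + (x ∸ 1) ≡ + x - + 1
+[x∸1]≡ (s≤s _) = refl

+[x∸2]≡ : ∀ {x} → 2 ≤ x → + (x ∸ 2) ≡ + x - + 2
+[x∸2]≡ (s≤s (s≤s _)) = refl

+[1+x]≡ : ∀ x → + suc x ≡ + x + + 1
+[1+x]≡ x = trans (cong +_ (ℕP.+-comm 1 x)) (ℤP.pos-+ x 1)

combine-δ : ∀ a i j → 1 ≤ a i → 1 ≤ a (i + + 1) →
  + combine a i j ≡ + a j + (- + 1 * δ i j + (- + 1 * δ (i + + 1) j + + 1 * δ (i + + 2) j))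
combine-δ a i j ai ai+1 with j ≟ i | j ≟ i + + 1 | j ≟ i + + 2
... | yes refl | yes eq   | _        = ⊥-elim (i+1≢i i (sym eq))
... | yes refl | no  _    | yes eq   = ⊥-elim (i+2≢i i (sym eq))
... | yes refl | no  _    | no  _    = +[x∸1]≡ ai
... | no  _    | yes refl | yes eq   = ⊥-elim (i+2≢i+1 i (sym eq))
... | no  _    | yes refl | no  _    = +[x∸1]≡ ai+1
... | no  _    | no  _    | yes refl = +[1+x]≡ (a (i + + 2))
... | no  _    | no  _    | no  _    = sym (ℤP.+-identityʳ (+ a j))

split-δ : ∀ a i j → 2 ≤ a i →
  + split a i j ≡ + a j + (- + 2 * δ i j + (+ 1 * δ (i + + 1) j + + 1 * δ (i - + 2) j))
split-δ a i j ai with j ≟ i | j ≟ i + + 1 | j ≟ i - + 2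
... | yes refl | yes eq   | _        = ⊥-elim (i+1≢i i (sym eq))
... | yes refl | no  _    | yes eq   = ⊥-elim (i-2≢i i (sym eq))
... | yes refl | no  _    | no  _    = +[x∸2]≡ ai
... | no  _    | yes refl | yes eq   = ⊥-elim (i-2≢i+1 i (sym eq))
... | no  _    | yes refl | no  _    = +[1+x]≡ (a (i + + 1))
... | no  _    | no  _    | yes refl = +[1+x]≡ (a (i - + 2))
... | no  _    | no  _    | no  _    = sym (ℤP.+-identityʳ (+ a j))

combine-support : ∀ a i j → 1 ≤ combine a i j → 1 ≤ a j ⊎ j ≡ i + + 2
combine-support a i j 1≤b with j ≟ i | j ≟ i + + 1 | j ≟ i + + 2
... | yes _ | _     | _      = inj₁ (ℕP.≤-trans 1≤b (ℕP.m∸n≤m (a j) 1))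
... | no  _ | yes _ | _      = inj₁ (ℕP.≤-trans 1≤b (ℕP.m∸n≤m (a j) 1))
... | no  _ | no  _ | yes eq = inj₂ eq
... | no  _ | no  _ | no  _  = inj₁ 1≤b

split-support : ∀ a i j → 1 ≤ split a i j → 1 ≤ a j ⊎ j ≡ i + + 1 ⊎ j ≡ i - + 2
split-support a i j 1≤b with j ≟ i | j ≟ i + + 1 | j ≟ i - + 2
... | yes _ | _      | _      = inj₁ (ℕP.≤-trans 1≤b (ℕP.m∸n≤m (a j) 2))
... | no  _ | yes eq | _      = inj₂ (inj₁ eq)
... | no  _ | no  _  | yes eq = inj₂ (inj₂ eq)
... | no  _ | no  _  | no  _  = inj₁ 1≤b

SupportedIn : ℕ → State → Set
SupportedIn R a = ∀ j → 1 ≤ a j → Window R j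

window-mono : ∀ {R R′ j} → R ≤ R′ → Window R j → Window R′ j
window-mono R≤R′ (-R≤j , j≤R) = ℤP.≤-trans (ℤP.neg-mono-≤ (+≤+ R≤R′)) -R≤j , ℤP.≤-trans j≤R (+≤+ R≤R′)

window-shift : ∀ {R i} d → Window R i → - + 2 ℤ.≤ d → d ℤ.≤ + 2 → Window (2 ℕ.+ R) (i + d)
window-shift {R} {i} d (-R≤i , i≤R) -2≤d d≤2 =
  subst (ℤ._≤ i + d) -[2+R]≡ (ℤP.+-mono-≤ -R≤i -2≤d) , subst (i + d ℤ.≤_) [2+R]≡ (ℤP.+-mono-≤ i≤R d≤2)
  where
  [2+R]≡ : + R + + 2 ≡ + (2 ℕ.+ R)
  [2+R]≡ = trans (sym (ℤP.pos-+ R 2)) (cong +_ (ℕP.+-comm R 2))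
  -[2+R]≡ : - + R + - + 2 ≡ - + (2 ℕ.+ R)
  -[2+R]≡ = trans (sym (ℤP.neg-distrib-+ (+ R) (+ 2))) (cong -_ [2+R]≡)

supportedIn-move : ∀ {R a b} → SupportedIn R a → Move a b → SupportedIn (2 ℕ.+ R) b
supportedIn-move {R} {a} supp (combineMove i ai _ b≗) j 1≤bj
  with combine-support a i j (subst (1 ≤_) (b≗ j) 1≤bj)
... | inj₁ 1≤aj = window-mono (ℕP.m≤n+m R 2) (supp j 1≤aj)
... | inj₂ refl = window-shift (+ 2) (supp i ai) -≤+ ℤP.≤-refl
supportedIn-move {R} {a} supp (splitMove i ai b≗) j 1≤bj
  with split-support a i j (subst (1 ≤_) (b≗ j) 1≤bj)
... | inj₁ 1≤aj        = window-mono (ℕP.m≤n+m R 2) (supp j 1≤aj)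
... | inj₂ (inj₁ refl) = window-shift (+ 1) (supp i (ℕP.≤-trans (s≤s z≤n) ai)) -≤+ (+≤+ (s≤s z≤n))
... | inj₂ (inj₂ refl) = window-shift (- + 2) (supp i (ℕP.≤-trans (s≤s z≤n) ai)) ℤP.≤-refl -≤+

init-supported : ∀ n → SupportedIn 0 (init n)
init-supported n j 1≤init with j ≟ + 0
... | yes refl = ℤP.≤-refl , ℤP.≤-refl

radius : ∀ {a b} → ReachableFrom a b → ℕ
radius (start _)  = 0
radius (step d _) = 2 ℕ.+ radius d

supportedIn-reachable : ∀ {n b} (d : ReachableFrom (init n) b) → SupportedIn (radius d) b
supportedIn-reachable {n} (start b≗init) j 1≤bj = init-supported n j (subst (1 ≤_) (b≗init j) 1≤bj)
supportedIn-reachable (step d mv) = supportedIn-move (supportedIn-reachable d) mv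

window-near : ∀ {B R i} d → Window B i → 2 ℕ.+ B ≤ R → - + 2 ℤ.≤ d → d ℤ.≤ + 2 → Window R (i + d)
window-near d i∈B 2+B≤R -2≤d d≤2 = window-mono 2+B≤R (window-shift d i∈B -2≤d d≤2)

module Potential (W : ℤ → ℤ) (W-fib : FibonacciLike W) where

  potential : ℕ → State → ℤ
  potential R a = windowSum R (λ j → + a j * W j)

  potential-cong : ∀ R {a b} → (∀ j → a j ≡ b j) → potential R a ≡ potential R b
  potential-cong R a≗b = sumTo-cong (suc (R ℕ.+ R)) (λ u → cong (λ x → + x * W (+ R - + u)) (a≗b (+ R - + u)))

  potential-init : ∀ R n → potential R (init n) ≡ + n * W (+ 0)
  potential-init R n =
    trans (sumTo-cong (suc (R ℕ.+ R)) {h = λ u → δ (+ 0) (+ R - + u) * (+ n * W (+ R - + u))}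
                      (λ u → init≡δ (+ R - + u)))
          (windowSum-δ {R} {+ 0} (λ j → + n * W j) (ℤP.neg-≤-pos , +≤+ z≤n))
    where
    init≡δ : ∀ j → + init n j * W j ≡ δ (+ 0) j * (+ n * W j)
    init≡δ j with j ≟ + 0
    ... | yes _ = sym (ℤP.*-identityˡ (+ n * W j))
    ... | no  _ = refl

  potential-stable : ∀ R {a b} (Δ : ℤ → ℤ) → (∀ j → + b j ≡ + a j + Δ j) →
                     windowSum R (λ j → Δ j * W j) ≡ + 0 → potential R b ≡ potential R a
  potential-stable R {a} {b} Δ b≡a+Δ ΣΔW≡0 = begin
    potential R b
      ≡⟨ sumTo-cong (suc (R ℕ.+ R)) {h = λ u → + a (j u) * W (j u) + Δ (j u) * W (j u)}
           (λ u → trans (cong (_* W (j u)) (b≡a+Δ (j u))) (ℤP.*-distribʳ-+ (W (j u)) (+ a (j u)) (Δ (j u)))) ⟩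
    sumTo (suc (R ℕ.+ R)) (λ u → + a (j u) * W (j u) + Δ (j u) * W (j u))
      ≡⟨ sumTo-+ (suc (R ℕ.+ R)) (λ u → + a (j u) * W (j u)) (λ u → Δ (j u) * W (j u)) ⟩
    potential R a + windowSum R (λ j → Δ j * W j)
      ≡⟨ cong (_+_ (potential R a)) ΣΔW≡0 ⟩
    potential R a + + 0
      ≡⟨ ℤP.+-identityʳ (potential R a) ⟩
    potential R a
      ∎
    where
    open ≡-Reasoning
    j : ℕ → ℤ
    j u = + R - + u

  combine-balance : ∀ i → - + 1 * W i + (- + 1 * W (i + + 1) + + 1 * W (i + + 2)) ≡ + 0
  combine-balance i = trans (cong (λ v → - + 1 * W i + (- + 1 * W (i + + 1) + + 1 * v)) (W-fib i))
                            (cancel (W i) (W (i + + 1)))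
    where
    cancel : ∀ x y → - + 1 * x + (- + 1 * y + + 1 * (y + x)) ≡ + 0
    cancel = ℤ-Solver.solve-∀

  split-balance : ∀ i → - + 2 * W i + (+ 1 * W (i + + 1) + + 1 * W (i - + 2)) ≡ + 0
  split-balance i = begin
    - + 2 * W i + (+ 1 * W (i + + 1) + + 1 * x)       ≡⟨ cong (λ v → - + 2 * W i + (+ 1 * v + + 1 * x)) Wi+1≡ ⟩
    - + 2 * W i + (+ 1 * (W i + y) + + 1 * x)         ≡⟨ cong (λ v → - + 2 * v + (+ 1 * (v + y) + + 1 * x)) Wi≡ ⟩
    - + 2 * (y + x) + (+ 1 * (y + x + y) + + 1 * x)   ≡⟨ cancel x y ⟩
    + 0                                               ∎
    where
    open ≡-Reasoning
    x = W (i - + 2)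
    y = W (i - + 1)
    i-2+2 : ∀ i → i - + 2 + + 2 ≡ i
    i-2+2 = ℤ-Solver.solve-∀
    i-2+1 : ∀ i → i - + 2 + + 1 ≡ i - + 1
    i-2+1 = ℤ-Solver.solve-∀
    i-1+2 : ∀ i → i - + 1 + + 2 ≡ i + + 1
    i-1+2 = ℤ-Solver.solve-∀
    i-1+1 : ∀ i → i - + 1 + + 1 ≡ i
    i-1+1 = ℤ-Solver.solve-∀
    Wi≡ : W i ≡ y + x
    Wi≡ = trans (cong W (sym (i-2+2 i))) (trans (W-fib (i - + 2)) (cong (λ v → W v + x) (i-2+1 i)))
    Wi+1≡ : W (i + + 1) ≡ W i + y
    Wi+1≡ = trans (cong W (sym (i-1+2 i))) (trans (W-fib (i - + 1)) (cong (λ v → W v + y) (i-1+1 i)))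
    cancel : ∀ x y → - + 2 * (y + x) + (+ 1 * (y + x + y) + + 1 * x) ≡ + 0
    cancel = ℤ-Solver.solve-∀

  potential-move : ∀ {R B a b} → SupportedIn B a → 2 ℕ.+ B ≤ R → Move a b → potential R b ≡ potential R a
  potential-move {R} {B} {a} supp 2+B≤R (combineMove i ai ai+1 b≗) =
    potential-stable R (λ j → - + 1 * δ i j + (- + 1 * δ (i + + 1) j + + 1 * δ (i + + 2) j))
      (λ j → trans (cong +_ (b≗ j)) (combine-δ a i j ai ai+1))
      (trans (windowSum-δ³ (- + 1) (- + 1) (+ 1) W
                (window-mono (ℕP.≤-trans (ℕP.m≤n+m B 2) 2+B≤R) (supp i ai))
                (window-near (+ 1) (supp i ai) 2+B≤R -≤+ (+≤+ (s≤s z≤n)))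
                (window-near (+ 2) (supp i ai) 2+B≤R -≤+ ℤP.≤-refl))
             (combine-balance i))
  potential-move {R} {B} {a} supp 2+B≤R (splitMove i ai b≗) =
    potential-stable R (λ j → - + 2 * δ i j + (+ 1 * δ (i + + 1) j + + 1 * δ (i - + 2) j))
      (λ j → trans (cong +_ (b≗ j)) (split-δ a i j ai))
      (trans (windowSum-δ³ (- + 2) (+ 1) (+ 1) W
                (window-mono (ℕP.≤-trans (ℕP.m≤n+m B 2) 2+B≤R) i∈B)
                (window-near (+ 1) i∈B 2+B≤R -≤+ (+≤+ (s≤s z≤n)))
                (window-near (- + 2) i∈B 2+B≤R ℤP.≤-refl -≤+))
             (split-balance i))
    where
    i∈B : Window B i
    i∈B = supp i (ℕP.≤-trans (s≤s z≤n) ai)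

  potential-reachable : ∀ {n b R} (d : ReachableFrom (init n) b) → radius d ≤ R → potential R b ≡ + n * W (+ 0)
  potential-reachable {n} {R = R} (start b≗init) _ = trans (potential-cong R b≗init) (potential-init R n)
  potential-reachable (step d mv) 2+r≤R =
    trans (potential-move (supportedIn-reachable d) 2+r≤R mv)
          (potential-reachable d (ℕP.≤-trans (ℕP.m≤n+m (radius d) 2) 2+r≤R))

fibSum : (ℕ → ℕ) → ℕ → ℤ
fibSum g K = sumTo K (λ u → + g u * fibℤ (- + u))

-- u counts leftwards from the right end R of the window, where the weight fibℤ (j - R) is F(-u).
fibSum-reachable : ∀ {n b} (d : ReachableFrom (init n) b) {N} →
  (∀ u → N ≤ u → b (+ radius d - + u) ≡ 0) → N ≤ suc (radius d ℕ.+ radius d) →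
  fibSum (λ u → b (+ radius d - + u)) N ≡ + n * fibℤ (- + radius d)
fibSum-reachable {n} {b} d {N} vanish N≤len = begin
  fibSum g N
    ≡⟨ sumTo-tail (suc (R ℕ.+ R)) _ (λ u N≤u → cong (λ x → + x * fibℤ (- + u)) (vanish u N≤u)) N≤len ⟨
  fibSum g (suc (R ℕ.+ R))
    ≡⟨ sumTo-cong (suc (R ℕ.+ R)) (λ u → cong (λ j → + g u * fibℤ j) (R-u-R≡-u u)) ⟩
  potential R b
    ≡⟨ potential-reachable d ℕP.≤-refl ⟩
  + n * fibℤ (+ 0 - + R)
    ≡⟨ cong (λ j → + n * fibℤ j) (ℤP.+-identityˡ (- + R)) ⟩
  + n * fibℤ (- + R)
    ∎
  where
  open ≡-Reasoning
  R = radius d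
  open Potential (λ j → fibℤ (j - + R)) (fibonacciLike-shift {fibℤ} fibℤ-fibonacciLike (- + R))
  g : ℕ → ℕ
  g u = b (+ R - + u)
  R-u-R≡-u : ∀ u → - + u ≡ + R - + u - + R
  R-u-R≡-u u = solve (+ R) (+ u)
    where
    solve : ∀ r u → - u ≡ r - u - r
    solve = ℤ-Solver.solve-∀

altFibSum : (ℕ → ℕ) → ℕ → ℤ
altFibSum g j = σ (suc j) * fibSum g (suc j)

altFibSum-zero : ∀ g → altFibSum g 0 ≡ + 0
altFibSum-zero g = cong (λ v → - + 1 * (+ 0 + v)) (ℤP.*-zeroʳ (+ g 0))

altFibSum-suc : ∀ g j → altFibSum g (suc j) ≡ + (g (suc j) ℕ.* fib (suc j)) - altFibSum g j
altFibSum-suc g j = begin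
  - - σ j * (S + G * (σ j * Φ))      ≡⟨ regroup (σ j) S G Φ ⟩
  σ j * σ j * (G * Φ) - (- σ j * S)  ≡⟨ cong (λ v → v * (G * Φ) - (- σ j * S)) (σ*σ≡1 j) ⟩
  + 1 * (G * Φ) - (- σ j * S)        ≡⟨ cong (_- (- σ j * S)) (trans (ℤP.*-identityˡ (G * Φ)) G*Φ≡) ⟩
  + (g (suc j) ℕ.* fib (suc j)) - altFibSum g j ∎
  where
  open ≡-Reasoning
  S = fibSum g (suc j)
  G = + g (suc j)
  Φ = + fib (suc j)
  G*Φ≡ : G * Φ ≡ + (g (suc j) ℕ.* fib (suc j))
  G*Φ≡ = sym (ℤP.pos-* (g (suc j)) (fib (suc j)))
  regroup : ∀ t s a f → - - t * (s + a * (t * f)) ≡ t * t * (a * f) - (- t * s)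
  regroup = ℤ-Solver.solve-∀

altFibSum-suc-0 : ∀ g j → g (suc j) ≡ 0 → altFibSum g (suc j) ≡ - altFibSum g j
altFibSum-suc-0 g j g≡0 = trans (altFibSum-suc g j)
  (trans (cong (λ x → + (x ℕ.* fib (suc j)) - altFibSum g j) g≡0) (ℤP.+-identityˡ (- altFibSum g j)))

altFibSum-suc-1 : ∀ g j → g (suc j) ≡ 1 → altFibSum g (suc j) ≡ + fib (suc j) - altFibSum g j
altFibSum-suc-1 g j g≡1 = trans (altFibSum-suc g j)
  (cong (λ x → + x - altFibSum g j) (trans (cong (ℕ._* fib (suc j)) g≡1) (ℕP.*-identityˡ (fib (suc j)))))

altFibSum-bounds : ∀ g → (∀ u → g u ≤ 1) → ∀ j → - + fib j ℤ.≤ altFibSum g j × altFibSum g j ℤ.≤ + fib (suc j)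
altFibSum-bounds g g≤1 zero rewrite altFibSum-zero g = ℤP.≤-refl , +≤+ z≤n
altFibSum-bounds g g≤1 (suc j) = lower , upper
  where
  open ℤP.≤-Reasoning
  x = altFibSum g j
  c = g (suc j) ℕ.* fib (suc j)
  c≤ : c ≤ fib (suc j)
  c≤ = ℕP.≤-trans (ℕP.*-monoˡ-≤ (fib (suc j)) (g≤1 (suc j))) (ℕP.≤-reflexive (ℕP.*-identityˡ (fib (suc j))))
  lower : - + fib (suc j) ℤ.≤ altFibSum g (suc j)
  lower = begin
    - + fib (suc j)      ≡⟨ ℤP.+-identityˡ (- + fib (suc j)) ⟨
    + 0 - + fib (suc j)  ≤⟨ ℤP.+-mono-≤ (+≤+ z≤n) (ℤP.neg-mono-≤ (proj₂ (altFibSum-bounds g g≤1 j))) ⟩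
    + c - x              ≡⟨ altFibSum-suc g j ⟨
    altFibSum g (suc j)  ∎
  upper : altFibSum g (suc j) ℤ.≤ + fib (suc (suc j))
  upper = begin
    altFibSum g (suc j)        ≡⟨ altFibSum-suc g j ⟩
    + c - x                    ≤⟨ ℤP.+-mono-≤ (+≤+ c≤) (ℤP.neg-mono-≤ (proj₁ (altFibSum-bounds g g≤1 j))) ⟩
    + fib (suc j) - - + fib j  ≡⟨ cong (_+_ (+ fib (suc j))) (ℤP.neg-involutive (+ fib j)) ⟩
    + fib (suc j) + + fib j    ≡⟨ cong +_ (ℕP.+-comm (fib (suc j)) (fib j)) ⟩
    + fib (suc (suc j))        ∎

altFibSum-gap : ∀ g j → (∀ u → g u ≤ 1) → g (2 ℕ.+ j) ≡ 1 → g (1 ℕ.+ j) ≡ 0 →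
                + fib (1 ℕ.+ j) ℤ.≤ altFibSum g (2 ℕ.+ j)
altFibSum-gap g j g≤1 g₂≡1 g₁≡0 = begin
  + fib (1 ℕ.+ j)                      ≡⟨ cancel (+ fib j) (+ fib (1 ℕ.+ j)) ⟨
  + fib j + + fib (1 ℕ.+ j) - + fib j  ≤⟨ ℤP.+-monoʳ-≤ (+ fib (2 ℕ.+ j)) (proj₁ (altFibSum-bounds g g≤1 j)) ⟩
  + fib (2 ℕ.+ j) + altFibSum g j      ≡⟨ cong (_+_ (+ fib (2 ℕ.+ j))) (ℤP.neg-involutive (altFibSum g j)) ⟨
  + fib (2 ℕ.+ j) - - altFibSum g j    ≡⟨ cong (λ x → + fib (2 ℕ.+ j) - x) (altFibSum-suc-0 g j g₁≡0) ⟨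
  + fib (2 ℕ.+ j) - altFibSum g (1 ℕ.+ j) ≡⟨ altFibSum-suc-1 g (suc j) g₂≡1 ⟨
  altFibSum g (2 ℕ.+ j)                ∎
  where
  open ℤP.≤-Reasoning
  cancel : ∀ a b → a + b - a ≡ b
  cancel = ℤ-Solver.solve-∀

altFibSum-run : ∀ g j → (∀ u → g u ≤ 1) → g (3 ℕ.+ j) ≡ 1 → g (2 ℕ.+ j) ≡ 1 → g (1 ℕ.+ j) ≡ 1 →
                + fib (1 ℕ.+ j) ℤ.≤ altFibSum g (3 ℕ.+ j)
altFibSum-run g j g≤1 g₃≡1 g₂≡1 g₁≡1 = begin
  + F₁                     ≡⟨ ℤP.+-identityʳ (+ F₁) ⟨
  + F₁ + + 0               ≤⟨ ℤP.+-monoʳ-≤ (+ F₁) (ℤP.i≤j⇒0≤j-i (proj₂ (altFibSum-bounds g g≤1 j))) ⟩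
  + F₁ + (+ F₁ - x)        ≡⟨ regroup (+ F₁) (+ F₂) x ⟩
  + F₁ + + F₂ - (+ F₂ - (+ F₁ - x))
                           ≡⟨ cong (λ y → + fib (3 ℕ.+ j) - (+ F₂ - y)) (altFibSum-suc-1 g j g₁≡1) ⟨
  + fib (3 ℕ.+ j) - (+ F₂ - altFibSum g (1 ℕ.+ j))
                           ≡⟨ cong (λ y → + fib (3 ℕ.+ j) - y) (altFibSum-suc-1 g (1 ℕ.+ j) g₂≡1) ⟨
  + fib (3 ℕ.+ j) - altFibSum g (2 ℕ.+ j)
                           ≡⟨ altFibSum-suc-1 g (2 ℕ.+ j) g₃≡1 ⟨
  altFibSum g (3 ℕ.+ j)    ∎
  where
  open ℤP.≤-Reasoning
  F₁ = fib (1 ℕ.+ j)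
  F₂ = fib (2 ℕ.+ j)
  x = altFibSum g j
  regroup : ∀ a b x → a + (a - x) ≡ a + b - (b - (a - x))
  regroup = ℤ-Solver.solve-∀

≤1⇒≡0⊎≡1 : ∀ {x} → x ≤ 1 → x ≡ 0 ⊎ x ≡ 1
≤1⇒≡0⊎≡1 z≤n       = inj₁ refl
≤1⇒≡0⊎≡1 (s≤s z≤n) = inj₂ refl

altFibSum-leftEdge : ∀ g y → (∀ u → g u ≤ 1) → g (5 ℕ.+ y) ≡ 1 → altFibSum g (5 ℕ.+ y) ℤ.≤ + fib (2 ℕ.+ y) →
                     g (4 ℕ.+ y) ≡ 1 × g (3 ℕ.+ y) ≡ 0
altFibSum-leftEdge g y g≤1 g₅≡1 x≤F = edge (≤1⇒≡0⊎≡1 (g≤1 (4 ℕ.+ y))) (≤1⇒≡0⊎≡1 (g≤1 (3 ℕ.+ y)))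
  where
  tooLarge : + fib (3 ℕ.+ y) ℤ.≤ altFibSum g (5 ℕ.+ y) → ⊥
  tooLarge F≤x = ℕP.<⇒≱ (fib-<-suc y) (ℤP.drop‿+≤+ (ℤP.≤-trans F≤x x≤F))
  edge : g (4 ℕ.+ y) ≡ 0 ⊎ g (4 ℕ.+ y) ≡ 1 → g (3 ℕ.+ y) ≡ 0 ⊎ g (3 ℕ.+ y) ≡ 1 → g (4 ℕ.+ y) ≡ 1 × g (3 ℕ.+ y) ≡ 0
  edge (inj₁ g₄≡0) _           = ⊥-elim (tooLarge (ℤP.≤-trans (+≤+ (fib-≤-suc (3 ℕ.+ y))) (altFibSum-gap g (3 ℕ.+ y) g≤1 g₅≡1 g₄≡0)))
  edge (inj₂ g₄≡1) (inj₁ g₃≡0) = g₄≡1 , g₃≡0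
  edge (inj₂ g₄≡1) (inj₂ g₃≡1) = ⊥-elim (tooLarge (altFibSum-run g (2 ℕ.+ y) g≤1 g₅≡1 g₄≡1 g₃≡1))

σ*[n*fibℤ-neg]≤ : ∀ j n u → σ j * (+ n * fibℤ (- + u)) ℤ.≤ + (n ℕ.* fib u)
σ*[n*fibℤ-neg]≤ j n u = ℤP.≤-trans (i≤+∣i∣ _) (ℤP.≤-reflexive (cong +_ (begin
  ∣ σ j * (+ n * fibℤ (- + u)) ∣  ≡⟨ ∣σ*∣ j (+ n * fibℤ (- + u)) ⟩
  ∣ + n * fibℤ (- + u) ∣          ≡⟨ ℤP.abs-* (+ n) (fibℤ (- + u)) ⟩
  n ℕ.* ∣ fibℤ (- + u) ∣          ≡⟨ cong (n ℕ.*_) (∣fibℤ-neg∣ u) ⟩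
  n ℕ.* fib u                     ∎)))
  where open ≡-Reasoning

altFibSum-reachable-≤ : ∀ {n b} (d : ReachableFrom (init n) b) N →
  1 ≤ b (+ radius d - + N) → (∀ u → suc N ≤ u → b (+ radius d - + u) ≡ 0) →
  altFibSum (λ u → b (+ radius d - + u)) N ℤ.≤ + (n ℕ.* fib (radius d))
altFibSum-reachable-≤ {n} {b} d N 1≤b[R-N] vanish = begin
  σ (suc N) * fibSum (λ u → b (+ R - + u)) (suc N)  ≡⟨ cong (σ (suc N) *_) (fibSum-reachable d vanish (s≤s N≤R+R)) ⟩
  σ (suc N) * (+ n * fibℤ (- + R))                  ≤⟨ σ*[n*fibℤ-neg]≤ (suc N) n R ⟩
  + (n ℕ.* fib R)                                    ∎
  where
  open ℤP.≤-Reasoning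
  R = radius d
  N≤R+R : N ≤ R ℕ.+ R
  N≤R+R = window-offset-≤ (supportedIn-reachable d _ 1≤b[R-N])

c-[1+u]+1≡c-u : ∀ c u → c - + suc u + + 1 ≡ c - + u
c-[1+u]+1≡c-u c u = solve c (+ u)
  where
  solve : ∀ c u → c - (+ 1 + u) + + 1 ≡ c - u
  solve = ℤ-Solver.solve-∀

R-[5+R+k]≡-k-5 : ∀ R k → + R - + (5 ℕ.+ (R ℕ.+ k)) ≡ - + k - + 5
R-[5+R+k]≡-k-5 R k = begin
  + R - + (5 ℕ.+ (R ℕ.+ k))      ≡⟨ cong (λ x → + R - x) (trans (ℤP.pos-+ 5 (R ℕ.+ k)) (cong (_+_ (+ 5)) (ℤP.pos-+ R k))) ⟩
  + R - (+ 5 + (+ R + + k))      ≡⟨ solve (+ R) (+ k) ⟩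
  - + k - + 5                    ∎
  where
  open ≡-Reasoning
  solve : ∀ r k → r - (+ 5 + (r + k)) ≡ - k - + 5
  solve = ℤ-Solver.solve-∀

mainTheorem3 : (n : ℕ) → 1 ≤ n → (T : State) → ReachableFrom (init n) T →
    (∀ i → T i ≤ 1) →
    (m : ℤ) → 1 ≤ T m → (∀ i → i < m → T i ≡ 0) →
    LeftBound n m →
    (T m ≡ 1) × (T (m + + 1) ≡ 1) × (T (m + + 2) ≡ 0)
mainTheorem3 n _ T reach T≤1 m 1≤Tm T[<m]≡0 (k , m≡-k-5 , n≤φ^k) =
  Tm≡1 , trans (cong T m+1≡) (proj₁ edge) , trans (cong T m+2≡) (proj₂ edge)
  where
  R = radius reach
  y = R ℕ.+ k
  m≡ : m ≡ + R - + (5 ℕ.+ y)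
  m≡ = trans m≡-k-5 (sym (R-[5+R+k]≡-k-5 R k))
  m+1≡ : m + + 1 ≡ + R - + (4 ℕ.+ y)
  m+1≡ = trans (cong (_+ + 1) m≡) (c-[1+u]+1≡c-u (+ R) (4 ℕ.+ y))
  m+2≡ : m + + 2 ≡ + R - + (3 ℕ.+ y)
  m+2≡ = trans (sym (ℤP.+-assoc m (+ 1) (+ 1))) (trans (cong (_+ + 1) m+1≡) (c-[1+u]+1≡c-u (+ R) (3 ℕ.+ y)))
  Tm≡1 : T m ≡ 1
  Tm≡1 = ℕP.≤-antisym (T≤1 m) 1≤Tm
  left-empty : ∀ u → 6 ℕ.+ y ≤ u → T (+ R - + u) ≡ 0
  left-empty u 6+y≤u = T[<m]≡0 _ (subst (+ R - + u <_) (sym m≡) (ℤP.+-monoʳ-< (+ R) (ℤP.neg-mono-< (+<+ 6+y≤u))))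
  n*fibR≤ : n ℕ.* fib R ≤ fib (2 ℕ.+ y)
  n*fibR≤ = ℕP.≤-trans (ℕP.*-monoˡ-≤ (fib R) (≤φ^⇒≤fib n k n≤φ^k))
                       (subst (λ z → fib (2 ℕ.+ k) ℕ.* fib R ≤ fib (2 ℕ.+ z)) (ℕP.+-comm k R) (fib-*-≤ (2 ℕ.+ k) R))
  edge : T (+ R - + (4 ℕ.+ y)) ≡ 1 × T (+ R - + (3 ℕ.+ y)) ≡ 0
  edge = altFibSum-leftEdge (λ u → T (+ R - + u)) y (λ u → T≤1 _) (trans (cong T (sym m≡)) Tm≡1)
           (ℤP.≤-trans (altFibSum-reachable-≤ reach (5 ℕ.+ y) (subst (λ i → 1 ≤ T i) m≡ 1≤Tm) left-empty) (+≤+ n*fibR≤))
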